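{- Let $1\le j\le n-1$ and let $O\subseteq Q$ be an order ideal of the type $(A_{n-1},j)$ poset $Q$ described in the context. An $\oplus$-diagram $D$ of shape $O$ is a $\Gamma$-diagram if and only if there is no box $z\in O$ with $D(z)=0$ such that some box below $z$ (same column, larger row index) contains a $+$ and some box to the left of $z$ (same row, smaller column index) contains a $+$.
   Context: $W=S_n$ is the Weyl group of type $A_{n-1}$ with simple reflections $s_i=(i,i+1)$, $1\le i\le n-1$, length function $\ell$ and Bruhat order $<$. $Q$ is the set of boxes $(r,c)$ with $1\le r\le j$ (rows numbered from top to bottom) and $1\le c\le n-j$ (columns from left to right); box $(r,c)$ carries the label $s_{(r,c)}:=s_{r+c-1}$. The partial order on $Q$ is the transitive closure of $(r,c)\lessdot(r,c+1)$ and $(r,c)\lessdot(r-1,c)$ (a box is smaller than the box to its right and than the box above it); an order ideal is a down-closed subset. An $\oplus$-diagram of shape $O$ is a map $D:O\to\{0,+\}$. Choose a linear extension $b_1,\dots,b_m$ of $O$ (so $b_k<b_l\Rightarrow k<l$) and write $s_{i_t}:=s_{b_{m+1-t}}$, so that $s_{i_1}\cdots s_{i_m}=s_{b_m}\cdots s_{b_1}$ (a reduced word). The subexpression of $D$ is $t_1\cdots t_m$ with $t_t=s_{i_t}$ if $D(b_{m+1-t})=0$ and $t_t=1$ if $D(b_{m+1-t})=+$; set $v_{(0)}=1$, $v_{(k)}=t_1\cdots t_k$, $v(D)=v_{(m)}$. $D$ is called a $\Gamma$-diagram if $v_{(k-1)}<v_{(k-1)}s_{i_k}$ for all $k=1,\dots,m$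 (a positive distinguished subexpression); this notion does not depend on the chosen linear extension. -}

module Defs where

open import Data.Nat using (ℕ; zero; suc; _+_; _∸_; _≤_; _<_; _<?_; _≡ᵇ_)
open import Data.Nat.Properties using ()
open import Data.Bool using (Bool; true; false; T; if_then_else_)
open import Data.Product using (Σ; ∃; _×_; _,_; proj₁; proj₂)
open import Data.Unit using (⊤)
open import Data.Fin using (Fin; toℕ)
open import Data.List using (List; []; _∷_; length; map; filter; upTo; reverse; lookup)
open import Data.List.Base using (cartesianProductWith)
open import Data.List.Relation.Unary.Unique.Propositional using (Unique)
open import Data.List.Membership.Propositional using (_∈_)
open import Relation.Nullary using (¬_)
open import Relation.Nullary.Decidable using (_×-dec_)
open import Relation.Binary.PropositionalEquality using (_≡_; _≢_)
open import Relation.Binary.Construct.Closure.Transitive using (TransClosure)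
open import Relation.Binary.Construct.Closure.ReflexiveTransitive using (Star)

-- A permutation w is the list [w(1), ..., w(n)]; list position p
-- (0-indexed) holds w(p+1).  The identity is [0, 1, ..., n-1]
-- (values are shifted by one as well, which is immaterial).

Perm : Set
Perm = List ℕ

idPerm : ℕ → Perm
idPerm n = upTo n

at : List ℕ → ℕ → ℕ
at []       _       = 0
at (x ∷ xs) zero    = x
at (x ∷ xs) (suc k) = at xs k

τ : ℕ → ℕ → ℕ → ℕ
τ a b k = if k ≡ᵇ a then b else (if k ≡ᵇ b then a else k)

rmulT : ℕ → ℕ → Perm → Perm
rmulT a b w = map (λ k → at w (τ a b k)) (upTo (length w))

-- right multiplication by the simple reflection s_i = (i, i+1),
-- 1 ≤ i ≤ n-1 (1-indexed values i, i+1 = 0-indexed positions i-1, i)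
rmulS : ℕ → Perm → Perm
rmulS i w = rmulT (i ∸ 1) i w

ℓ : Perm → ℕ
ℓ w = length (filter (λ pq → (proj₁ pq <? proj₂ pq) ×-dec (at w (proj₂ pq) <? at w (proj₁ pq)))
                     (cartesianProductWith _,_ (upTo (length w)) (upTo (length w))))

BruhatStep : ℕ → Perm → Perm → Set
BruhatStep n u w = Σ ℕ λ a → Σ ℕ λ b → a < b × b < n × w ≡ rmulT a b u × ℓ u < ℓ w

_<[_]B_ : Perm → ℕ → Perm → Set
u <[ n ]B w = TransClosure (BruhatStep n) u w

-- The poset Q of type (A_{n-1}, j).  Boxes (r , c), 1-indexed,
-- rows numbered top to bottom, columns left to right.

Box : Set
Box = ℕ × ℕ

InQ : ℕ → ℕ → Box → Set
InQ n j (r , c) = 1 ≤ r × r ≤ j × 1 ≤ c × c ≤ n ∸ j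

label : Box → ℕ
label (r , c) = r + c ∸ 1

data Cover (n j : ℕ) : Box → Box → Set where
  right : ∀ {r c} → InQ n j (r , c) → InQ n j (r , suc c) → Cover n j (r , c) (r , suc c)
  up    : ∀ {r c} → InQ n j (suc r , c) → InQ n j (r , c) → Cover n j (suc r , c) (r , c)

_≤[_,_]Q_ : Box → ℕ → ℕ → Box → Set
a ≤[ n , j ]Q b = Star (Cover n j) a b

_<[_,_]Q_ : Box → ℕ → ℕ → Box → Set
a <[ n , j ]Q b = a ≤[ n , j ]Q b × a ≢ b

Shape : Set
Shape = Box → Bool

_∈O_ : Box → Shape → Set
b ∈O O = T (O b)

IsOrderIdeal : ℕ → ℕ → Shape → Set
IsOrderIdeal n j O =
  (∀ b → b ∈O O → InQ n j b) ×
  (∀ a b → InQ n j a → b ∈O O → a ≤[ n , j ]Q b → a ∈O O)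

data Sym : Set where
  zer  : Sym
  plus : Sym

ElemO : Shape → Set
ElemO O = Σ Box λ b → b ∈O O

Diagram : Shape → Set
Diagram O = (b : Box) → b ∈O O → Sym

IsLinExt : ℕ → ℕ → (O : Shape) → List (ElemO O) → Set
IsLinExt n j O L =
  Unique (map proj₁ L) ×
  (∀ b → b ∈O O → b ∈ map proj₁ L) ×
  (∀ (k l : Fin (length L)) →
     proj₁ (lookup L k) <[ n , j ]Q proj₁ (lookup L l) → toℕ k < toℕ l)

-- positive distinguished subexpression condition, processing the
-- reduced word s_{i_1} ⋯ s_{i_m} with s_{i_t} = s_{b_{m+1-t}}
-- (i.e. the list b_m, ..., b_1), starting from the current v_{(k-1)}
PDS : ℕ → (O : Shape) → Diagram O → Perm → List (ElemO O) → Set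
PDS n O D v []             = ⊤
PDS n O D v ((b , p) ∷ bs) =
  (v <[ n ]B rmulS (label b) v) × PDS n O D (next (D b p)) bs
  where
  next : Sym → Perm
  next zer  = rmulS (label b) v
  next plus = v

IsΓ : ℕ → (O : Shape) → Diagram O → List (ElemO O) → Set
IsΓ n O D L = PDS n O D (idPerm n) (reverse L)

BadBox : (O : Shape) → Diagram O → Set
BadBox O D =
  Σ ℕ λ r → Σ ℕ λ c → Σ ((r , c) ∈O O) λ p →
    D (r , c) p ≡ zer ×
    (Σ ℕ λ r' → Σ ((r' , c) ∈O O) λ p' → r < r' × D (r' , c) p' ≡ plus) ×
    (Σ ℕ λ c' → Σ ((r , c') ∈O O) λ p' → c' < c × D (r , c') p' ≡ plus)

module Submission where

-- Write v_(k) in one-line notation.  The letter s_(r+c-1) of box (r , c) exchanges the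
-- entries at positions r+c-1 and r+c, which are the two values entering the box through its
-- top and its right edge: a 0 lets them cross, a + (like a box outside O) turns them.  As
-- u < u s_i in Bruhat order iff u(i) < u(i+1), D is a Γ-diagram iff at every box the value
-- from above is smaller than the value from the right, which no longer depends on the
-- linear extension.  Row by row: if the pattern does not occur above, the values entering
-- a row increase from left to right, except that they drop below a 0 having a + to its
-- left; then every box of the row is good, while a + placed below such a drop makes some
-- box of the row bad.

open import Defs
open import Data.Nat
open import Data.Nat.Properties
open import Data.Nat.ListAction using (sum)
open import Data.Nat.ListAction.Properties using (sum-++)
open import Data.Bool using (Bool; true; false; T)
open import Data.Product using (_×_; _,_; proj₁; proj₂; ∃; ∃₂; uncurry)
open import Data.Product.Function.NonDependent.Propositional using (_×-⇔_)
open import Data.Sum using (_⊎_; inj₁; inj₂; map₂)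
open import Data.Unit using (tt)
open import Data.Empty using (⊥-elim)
open import Data.Fin using (toℕ) renaming (zero to fzero; suc to fsuc)
open import Data.List using (List; []; _∷_; _++_; length; map; filter; upTo; applyUpTo; cartesianProductWith; reverse; lookup)
open import Data.List.Properties using (length-applyUpTo; map-applyUpTo; map-++; map-∘; unfold-reverse; reverse-map)
open import Data.List.Relation.Unary.All as All using (All; []; _∷_)
import Data.List.Relation.Unary.All.Properties as All
open import Data.List.Relation.Unary.Any using (here; there; index)
open import Data.List.Relation.Unary.Any.Properties using (reverse⁺; reverse⁻; lookup-index)
open import Data.List.Relation.Unary.AllPairs as AllPairs using (AllPairs; []; _∷_)
import Data.List.Relation.Unary.AllPairs.Properties as AllPairs
open import Data.List.Membership.Propositional using (_∈_)
open import Relation.Nullary using (¬_; Dec; yes; no)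
open import Relation.Nullary.Decidable using (_×-dec_; T?)
open import Relation.Binary.PropositionalEquality
open import Relation.Binary.Definitions using (tri<; tri≈; tri>)
open import Relation.Binary.Construct.Closure.Transitive using ([_]; _∷_)
open import Relation.Binary.Construct.Closure.ReflexiveTransitive using (ε; _◅_; _◅◅_)
open import Function using (_∘_; id; flip)
open import Function.Bundles using (_⇔_; mk⇔)
import Function.Properties.Equivalence as ⇔
open import Function.Related.TypeIsomorphisms using (¬-cong-⇔)
open import Level using (0ℓ)
import Relation.Binary.Reasoning.Setoid
import Algebra.Properties.CommutativeSemigroup +-commutativeSemigroup as +-CS

module ⇔-Reasoning = Relation.Binary.Reasoning.Setoid (⇔.⇔-setoid 0ℓ)

indicator : ∀ {P : Set} → Dec P → ℕ
indicator (yes _) = 1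
indicator (no _)  = 0

indicator-cong : ∀ {P Q : Set} (p? : Dec P) (q? : Dec Q) → (P → Q) → (Q → P) → indicator p? ≡ indicator q?
indicator-cong (yes _) (yes _) _   _   = refl
indicator-cong (yes p) (no ¬q) p→q _   = ⊥-elim (¬q (p→q p))
indicator-cong (no ¬p) (yes q) _   q→p = ⊥-elim (¬p (q→p q))
indicator-cong (no _)  (no _)  _   _   = refl

indicator-disjoint-⊎ : ∀ {P Q R : Set} (p? : Dec P) (q? : Dec Q) (r? : Dec R) →
  (P → Q ⊎ R) → (Q → P) → (R → P) → (Q → ¬ R) →
  indicator p? ≡ indicator q? + indicator r?
indicator-disjoint-⊎ (yes _) (yes q) (yes r) _ _ _ disj = ⊥-elim (disj q r)
indicator-disjoint-⊎ (yes _) (yes _) (no _)  _ _ _ _ = refl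
indicator-disjoint-⊎ (yes _) (no _)  (yes _) _ _ _ _ = refl
indicator-disjoint-⊎ (yes p) (no ¬q) (no ¬r) split _ _ _ with split p
... | inj₁ q = ⊥-elim (¬q q)
... | inj₂ r = ⊥-elim (¬r r)
indicator-disjoint-⊎ (no ¬p) (yes q) _       _ q→p _ _ = ⊥-elim (¬p (q→p q))
indicator-disjoint-⊎ (no ¬p) (no _)  (yes r) _ _ r→p _ = ⊥-elim (¬p (r→p r))
indicator-disjoint-⊎ (no _)  (no _)  (no _)  _ _ _ _ = refl

length-filter≡sum-indicator : ∀ {A : Set} {P : A → Set} (P? : ∀ x → Dec (P x)) (xs : List A) →
  length (filter P? xs) ≡ sum (map (indicator ∘ P?) xs)
length-filter≡sum-indicator P? []       = refl
length-filter≡sum-indicator P? (x ∷ xs) with P? x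
... | yes _ = cong suc (length-filter≡sum-indicator P? xs)
... | no _  = length-filter≡sum-indicator P? xs

sum-cartesianProduct : ∀ {A B : Set} (h : A × B → ℕ) (xs : List A) (ys : List B) →
  sum (map h (cartesianProductWith _,_ xs ys)) ≡ sum (map (λ x → sum (map (λ y → h (x , y)) ys)) xs)
sum-cartesianProduct h []       ys = refl
sum-cartesianProduct h (x ∷ xs) ys = begin
  sum (map h (map (x ,_) ys ++ cartesianProductWith _,_ xs ys))
    ≡⟨ cong sum (map-++ h (map (x ,_) ys) _) ⟩
  sum (map h (map (x ,_) ys) ++ map h (cartesianProductWith _,_ xs ys))
    ≡⟨ sum-++ (map h (map (x ,_) ys)) _ ⟩
  sum (map h (map (x ,_) ys)) + sum (map h (cartesianProductWith _,_ xs ys))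
    ≡⟨ cong₂ _+_ (cong sum (sym (map-∘ ys))) (sum-cartesianProduct h xs ys) ⟩
  sum (map (λ y → h (x , y)) ys) + sum (map (λ x → sum (map (λ y → h (x , y)) ys)) xs) ∎
  where open ≡-Reasoning

sumBelow : ℕ → (ℕ → ℕ) → ℕ
sumBelow n h = sum (applyUpTo h n)

sumBelow-cong : ∀ n {g h : ℕ → ℕ} → (∀ k → k < n → g k ≡ h k) → sumBelow n g ≡ sumBelow n h
sumBelow-cong zero    g≡h = refl
sumBelow-cong (suc n) g≡h = cong₂ _+_ (g≡h 0 z<s) (sumBelow-cong n (λ k k<n → g≡h (suc k) (s<s k<n)))

sumBelow-+ : ∀ n (g h : ℕ → ℕ) → sumBelow n (λ k → g k + h k) ≡ sumBelow n g + sumBelow n h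
sumBelow-+ zero    g h = refl
sumBelow-+ (suc n) g h = trans (cong (g 0 + h 0 +_) (sumBelow-+ n (g ∘ suc) (h ∘ suc)))
                               (+-CS.interchange (g 0) (h 0) _ _)

sumBelow-zero : ∀ n → sumBelow n (λ _ → 0) ≡ 0
sumBelow-zero zero    = refl
sumBelow-zero (suc n) = sumBelow-zero n

sumBelow-indicator-≟ : ∀ n a → a < n → sumBelow n (λ k → indicator (k ≟ a)) ≡ 1
sumBelow-indicator-≟ (suc n) zero    _ = cong suc (sumBelow-zero n)
sumBelow-indicator-≟ (suc n) (suc a) (s≤s a<n) = trans
  (sumBelow-cong n (λ k _ → indicator-cong (suc k ≟ suc a) (k ≟ a) suc-injective (cong suc)))
  (sumBelow-indicator-≟ n a a<n)

τ-fst : ∀ a b → τ a b a ≡ b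
τ-fst a b with a ≡ᵇ a in a≡ᵇa
... | true  = refl
... | false = ⊥-elim (subst T a≡ᵇa (≡⇒≡ᵇ a a refl))

τ-snd : ∀ a b → a ≢ b → τ a b b ≡ a
τ-snd a b a≢b with b ≡ᵇ a in b≡ᵇa
... | true  = ⊥-elim (a≢b (sym (≡ᵇ⇒≡ b a (subst T (sym b≡ᵇa) tt))))
... | false with b ≡ᵇ b in b≡ᵇb
...   | true  = refl
...   | false = ⊥-elim (subst T b≡ᵇb (≡⇒≡ᵇ b b refl))

τ-other : ∀ a b k → k ≢ a → k ≢ b → τ a b k ≡ k
τ-other a b k k≢a k≢b with k ≡ᵇ a in k≡ᵇa
... | true  = ⊥-elim (k≢a (≡ᵇ⇒≡ k a (subst T (sym k≡ᵇa) tt)))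
... | false with k ≡ᵇ b in k≡ᵇb
...   | true  = ⊥-elim (k≢b (≡ᵇ⇒≡ k b (subst T (sym k≡ᵇb) tt)))
...   | false = refl

data τ-View (a b k : ℕ) : Set where
  is-fst   : k ≡ a → τ a b k ≡ b → τ-View a b k
  is-snd   : k ≡ b → τ a b k ≡ a → τ-View a b k
  is-other : k ≢ a → k ≢ b → τ a b k ≡ k → τ-View a b k

τ-view : ∀ a b k → a ≢ b → τ-View a b k
τ-view a b k a≢b with k ≟ a | k ≟ b
... | yes refl | _        = is-fst refl (τ-fst a b)
... | no k≢a   | yes refl = is-snd refl (τ-snd a b a≢b)
... | no k≢a   | no k≢b   = is-other k≢a k≢b (τ-other a b k k≢a k≢b)

τ-involutive : ∀ a b k → a ≢ b → τ a b (τ a b k) ≡ k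
τ-involutive a b k a≢b with τ-view a b k a≢b
... | is-fst refl τk≡b   = trans (cong (τ a b) τk≡b) (τ-snd a b a≢b)
... | is-snd refl τk≡a   = trans (cong (τ a b) τk≡a) (τ-fst a b)
... | is-other _ _ τk≡k = trans (cong (τ a b) τk≡k) τk≡k

τ-< : ∀ a b k {n} → a < n → b < n → k < n → τ a b k < n
τ-< a b k a<n b<n k<n with k ≡ᵇ a
... | true = b<n
... | false with k ≡ᵇ b
...   | true  = a<n
...   | false = k<n

τ-suc : ∀ a b k → τ (suc a) (suc b) (suc k) ≡ suc (τ a b k)
τ-suc a b k with k ≡ᵇ a
... | true = refl
... | false with k ≡ᵇ b
...   | true  = refl
...   | false = refl

sumBelow-∘τ : ∀ n a (h : ℕ → ℕ) → suc a < n → sumBelow n (h ∘ τ a (suc a)) ≡ sumBelow n h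
sumBelow-∘τ (suc (suc n)) zero    h _ = +-CS.x∙yz≈y∙xz (h 1) (h 0) _
sumBelow-∘τ (suc n)       (suc a) h (s≤s a<n) = cong (h 0 +_) (trans
  (sumBelow-cong n (λ k _ → cong h (τ-suc a (suc a) k)))
  (sumBelow-∘τ n a (h ∘ suc) a<n))

at-applyUpTo : ∀ (f : ℕ → ℕ) n k → k < n → at (applyUpTo f n) k ≡ f k
at-applyUpTo f (suc n) zero    _         = refl
at-applyUpTo f (suc n) (suc k) (s≤s k<n) = at-applyUpTo (f ∘ suc) n k k<n

applyUpTo-cong : ∀ {A : Set} n {g h : ℕ → A} → (∀ k → k < n → g k ≡ h k) → applyUpTo g n ≡ applyUpTo h n
applyUpTo-cong zero    g≡h = refl
applyUpTo-cong (suc n) g≡h = cong₂ _∷_ (g≡h 0 z<s) (applyUpTo-cong n (λ k k<n → g≡h (suc k) (s<s k<n)))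

rmulS-applyUpTo : ∀ f n a → suc a < n → rmulS (suc a) (applyUpTo f n) ≡ applyUpTo (f ∘ τ a (suc a)) n
rmulS-applyUpTo f n a 1+a<n rewrite length-applyUpTo f n = trans
  (map-applyUpTo id _ n)
  (applyUpTo-cong n (λ k k<n → at-applyUpTo f n _ (τ-< a (suc a) k (<-trans (n<1+n a) 1+a<n) 1+a<n k<n)))

inversions : ℕ → (ℕ → ℕ) → ℕ
inversions n f = sumBelow n (λ p → sumBelow n (λ q → indicator ((p <? q) ×-dec (f q <? f p))))

inversions-cong : ∀ n {f g : ℕ → ℕ} → (∀ k → f k ≡ g k) → inversions n f ≡ inversions n g
inversions-cong n f≡g = sumBelow-cong n (λ p _ → sumBelow-cong n (λ q _ →
  cong₂ (λ x y → indicator ((p <? q) ×-dec (x <? y))) (f≡g q) (f≡g p)))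

ℓ-applyUpTo : ∀ f n → ℓ (applyUpTo f n) ≡ inversions n f
ℓ-applyUpTo f n rewrite length-applyUpTo f n = begin
  length (filter inv? (cartesianProductWith _,_ (upTo n) (upTo n)))
    ≡⟨ length-filter≡sum-indicator inv? (cartesianProductWith _,_ (upTo n) (upTo n)) ⟩
  sum (map (indicator ∘ inv?) (cartesianProductWith _,_ (upTo n) (upTo n)))
    ≡⟨ sum-cartesianProduct (indicator ∘ inv?) (upTo n) (upTo n) ⟩
  sum (map (λ p → sum (map (λ q → indicator (inv? (p , q))) (upTo n))) (upTo n))
    ≡⟨ cong sum (map-applyUpTo id _ n) ⟩
  sumBelow n (λ p → sum (map (λ q → indicator (inv? (p , q))) (upTo n)))
    ≡⟨ sumBelow-cong n (λ p p<n → cong sum (map-applyUpTo id _ n)) ⟩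
  sumBelow n (λ p → sumBelow n (λ q → indicator (inv? (p , q))))
    ≡⟨ sumBelow-cong n (λ p p<n → sumBelow-cong n (λ q q<n → cong₂ (λ x y → indicator ((p <? q) ×-dec (x <? y)))
                                                   (at-applyUpTo f n q q<n) (at-applyUpTo f n p p<n))) ⟩
  inversions n f ∎
  where
  open ≡-Reasoning
  w : Perm
  w = applyUpTo f n
  inv? : ∀ pq → Dec (proj₁ pq < proj₂ pq × at w (proj₂ pq) < at w (proj₁ pq))
  inv? (p , q) = (p <? q) ×-dec (at w q <? at w p)

module _ (a : ℕ) where

  private
    t : ℕ → ℕ
    t = τ a (suc a)

    a≢1+a : a ≢ suc a
    a≢1+a = <⇒≢ (n<1+n a)

    t∘t : ∀ k → t (t k) ≡ k
    t∘t k = τ-involutive a (suc a) k a≢1+a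

  τ-adjacent-mono-< : ∀ {p q} → ¬ (p ≡ a × q ≡ suc a) → p < q → t p < t q
  τ-adjacent-mono-< {p} {q} not-swapped p<q with τ-view a (suc a) p a≢1+a | τ-view a (suc a) q a≢1+a
  ... | is-fst refl tp | is-fst refl _  = ⊥-elim (<-irrefl refl p<q)
  ... | is-fst refl _  | is-snd refl _  = ⊥-elim (not-swapped (refl , refl))
  ... | is-fst refl tp | is-other _ q≢1+a tq = subst₂ _<_ (sym tp) (sym tq) (≤∧≢⇒< p<q (q≢1+a ∘ sym))
  ... | is-snd refl _  | is-fst refl _  = ⊥-elim (<-asym p<q (n<1+n a))
  ... | is-snd refl _  | is-snd refl _  = ⊥-elim (<-irrefl refl p<q)
  ... | is-snd refl tp | is-other _ _ tq = subst₂ _<_ (sym tp) (sym tq) (<-trans (n<1+n a) p<q)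
  ... | is-other _ _ tp | is-fst refl tq = subst₂ _<_ (sym tp) (sym tq) (<-trans p<q (n<1+n a))
  ... | is-other p≢a _ tp | is-snd refl tq = subst₂ _<_ (sym tp) (sym tq) (≤∧≢⇒< (≤-pred p<q) p≢a)
  ... | is-other _ _ tp | is-other _ _ tq = subst₂ _<_ (sym tp) (sym tq) p<q

  τ-adjacent-reflect-< : ∀ {p q} → ¬ (p ≡ suc a × q ≡ a) → t p < t q → p < q
  τ-adjacent-reflect-< {p} {q} not-swapped tp<tq =
    subst₂ _<_ (t∘t p) (t∘t q)
      (τ-adjacent-mono-< (λ { (tp≡a , tq≡1+a) → not-swapped (preimage tp≡a (τ-fst a (suc a)) ,
                                                               preimage tq≡1+a (τ-snd a (suc a) a≢1+a)) })
                          tp<tq)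
    where
    preimage : ∀ {k x y} → t k ≡ x → t x ≡ y → k ≡ y
    preimage {k} tk≡x tx≡y = trans (sym (t∘t k)) (trans (cong t tk≡x) tx≡y)

  module _ (f : ℕ → ℕ) (fa<fa+1 : f a < f (suc a)) where

    private
      inversion? : ∀ p q → Dec (p < q × f q < f p)
      inversion? p q = (p <? q) ×-dec (f q <? f p)

      swappedInversion? : ∀ p q → Dec (t p < t q × f q < f p)
      swappedInversion? p q = (t p <? t q) ×-dec (f q <? f p)

      isSwappedPair? : ∀ p q → Dec (p ≡ suc a × q ≡ a)
      isSwappedPair? p q = (p ≟ suc a) ×-dec (q ≟ a)

    swappedInversion-split : ∀ p q →
      indicator (swappedInversion? p q) ≡ indicator (inversion? p q) + indicator (isSwappedPair? p q)
    swappedInversion-split p q = indicator-disjoint-⊎ (swappedInversion? p q) (inversion? p q) (isSwappedPair? p q)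
      split
      (λ { (p<q , fq<fp) → τ-adjacent-mono-< (λ { (refl , refl) → <-asym fa<fa+1 fq<fp }) p<q , fq<fp })
      (λ { (refl , refl) → subst₂ _<_ (sym (τ-snd a (suc a) a≢1+a)) (sym (τ-fst a (suc a))) (n<1+n a) , fa<fa+1 })
      (λ { (p<q , _) (refl , refl) → <-asym p<q (n<1+n a) })
      where
      split : t p < t q × f q < f p → (p < q × f q < f p) ⊎ (p ≡ suc a × q ≡ a)
      split (tp<tq , fq<fp) with isSwappedPair? p q
      ... | yes swapped     = inj₂ swapped
      ... | no not-swapped = inj₁ (τ-adjacent-reflect-< not-swapped tp<tq , fq<fp)

    inversions-∘τ : ∀ n → suc a < n → inversions n (f ∘ t) ≡ suc (inversions n f)
    inversions-∘τ n 1+a<n = begin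
      inversions n (f ∘ t)
        ≡⟨ sumBelow-cong n (λ p _ → sumBelow-cong n (λ q _ → indicator-cong _ (swappedInversion? (t p) (t q))
             (λ { (p<q , fq<fp) → subst₂ _<_ (sym (t∘t p)) (sym (t∘t q)) p<q , fq<fp })
             (λ { (p<q , fq<fp) → subst₂ _<_ (t∘t p) (t∘t q) p<q , fq<fp }))) ⟩
      sumBelow n (λ p → sumBelow n (λ q → indicator (swappedInversion? (t p) (t q))))
        ≡⟨ sumBelow-cong n (λ p _ → sumBelow-∘τ n a (λ q → indicator (swappedInversion? (t p) q)) 1+a<n) ⟩
      sumBelow n (λ p → sumBelow n (λ q → indicator (swappedInversion? (t p) q)))
        ≡⟨ sumBelow-∘τ n a (λ p → sumBelow n (λ q → indicator (swappedInversion? p q))) 1+a<n ⟩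
      sumBelow n (λ p → sumBelow n (λ q → indicator (swappedInversion? p q)))
        ≡⟨ sumBelow-cong n (λ p _ → trans (sumBelow-cong n (λ q _ → swappedInversion-split p q)) (sumBelow-+ n _ _)) ⟩
      sumBelow n (λ p → sumBelow n (λ q → indicator (inversion? p q))
                      + sumBelow n (λ q → indicator (isSwappedPair? p q)))
        ≡⟨ sumBelow-+ n _ _ ⟩
      inversions n f + sumBelow n (λ p → sumBelow n (λ q → indicator (isSwappedPair? p q)))
        ≡⟨ cong (inversions n f +_) (trans (sumBelow-cong n (λ p _ → row p)) (sumBelow-indicator-≟ n (suc a) 1+a<n)) ⟩
      inversions n f + 1
        ≡⟨ +-comm _ 1 ⟩
      suc (inversions n f) ∎
      where
      open ≡-Reasoning
      row : ∀ p → sumBelow n (λ q → indicator (isSwappedPair? p q)) ≡ indicator (p ≟ suc a)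
      row p = by-cases (p ≟ suc a)
        where
        by-cases : (p≟1+a : Dec (p ≡ suc a)) → sumBelow n (λ q → indicator (isSwappedPair? p q)) ≡ indicator p≟1+a
        by-cases (yes p≡1+a) = trans
          (sumBelow-cong n (λ q _ → indicator-cong (isSwappedPair? p q) (q ≟ a) proj₂ (p≡1+a ,_)))
          (sumBelow-indicator-≟ n a (<-trans (n<1+n a) 1+a<n))
        by-cases (no p≢1+a)  = trans
          (sumBelow-cong n (λ q _ → indicator-cong (isSwappedPair? p q) (no (λ ())) (p≢1+a ∘ proj₁) λ ()))
          (sumBelow-zero n)

<B⇒ℓ< : ∀ {n u w} → u <[ n ]B w → ℓ u < ℓ w
<B⇒ℓ< [ _ , _ , _ , _ , _ , ℓu<ℓw ]        = ℓu<ℓw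
<B⇒ℓ< ((_ , _ , _ , _ , _ , ℓu<ℓv) ∷ v<w) = <-trans ℓu<ℓv (<B⇒ℓ< v<w)

<B-rmulS⇔ : ∀ f n a → suc a < n → (applyUpTo f n <[ n ]B rmulS (suc a) (applyUpTo f n)) ⇔ (f a < f (suc a))
<B-rmulS⇔ f n a 1+a<n = mk⇔ to from
  where
  t : ℕ → ℕ
  t = τ a (suc a)

  a≢1+a : a ≢ suc a
  a≢1+a = <⇒≢ (n<1+n a)

  ℓ-rmulS : ℓ (rmulS (suc a) (applyUpTo f n)) ≡ inversions n (f ∘ t)
  ℓ-rmulS = trans (cong ℓ (rmulS-applyUpTo f n a 1+a<n)) (ℓ-applyUpTo (f ∘ t) n)

  from : f a < f (suc a) → applyUpTo f n <[ n ]B rmulS (suc a) (applyUpTo f n)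
  from fa<fa+1 = [ a , suc a , n<1+n a , 1+a<n , refl , subst₂ _<_ (sym (ℓ-applyUpTo f n)) (sym ℓ-rmulS) ℓ< ]
    where
    ℓ< : inversions n f < inversions n (f ∘ t)
    ℓ< = ≤-reflexive (sym (inversions-∘τ a f fa<fa+1 n 1+a<n))

  to : applyUpTo f n <[ n ]B rmulS (suc a) (applyUpTo f n) → f a < f (suc a)
  to w<ws with <-cmp (f a) (f (suc a)) | <B⇒ℓ< w<ws
  ... | tri< fa<fa+1 _ _ | _ = fa<fa+1
  ... | tri≈ _ fa≡fa+1 _ | ℓ< =
    ⊥-elim (<-irrefl (trans (ℓ-applyUpTo f n) (trans (inversions-cong n f≗f∘t) (sym ℓ-rmulS))) ℓ<)
    where
    f≗f∘t : ∀ k → f k ≡ f (t k)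
    f≗f∘t k with τ-view a (suc a) k a≢1+a
    ... | is-fst refl tk     = trans fa≡fa+1 (cong f (sym tk))
    ... | is-snd refl tk     = trans (sym fa≡fa+1) (cong f (sym tk))
    ... | is-other _ _ tk    = cong f (sym tk)
  ... | tri> _ _ fa+1<fa | ℓ< = ⊥-elim (<-asym ℓ< (subst₂ _<_ (sym ℓ-rmulS) (sym (ℓ-applyUpTo f n)) ℓ>))
    where
    f∘t∘t≗f : ∀ k → f (t (t k)) ≡ f k
    f∘t∘t≗f k = cong f (τ-involutive a (suc a) k a≢1+a)
    ℓ> : inversions n (f ∘ t) < inversions n f
    ℓ> = ≤-reflexive (begin
      suc (inversions n (f ∘ t))  ≡⟨ inversions-∘τ a (f ∘ t) fa+1<fa' n 1+a<n ⟨
      inversions n (f ∘ t ∘ t)    ≡⟨ inversions-cong n f∘t∘t≗f ⟩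
      inversions n f              ∎)
      where
      open ≡-Reasoning
      fa+1<fa' : f (t a) < f (t (suc a))
      fa+1<fa' = subst₂ _<_ (sym (cong f (τ-fst a (suc a)))) (sym (cong f (τ-snd a (suc a) a≢1+a))) fa+1<fa

module _ {A : Set} where

  All-reverse⁺ : ∀ {P : A → Set} {xs} → All P xs → All P (reverse xs)
  All-reverse⁺ pxs = All.tabulate (All.lookup pxs ∘ reverse⁻)

  All-lookup⁺ : ∀ {P : A → Set} xs → (∀ k → P (lookup xs k)) → All P xs
  All-lookup⁺ {P} xs P-lookup = All.tabulate (λ x∈xs → subst P (sym (lookup-index x∈xs)) (P-lookup (index x∈xs)))

  AllPairs-lookup⁺ : ∀ {R : A → A → Set} xs →
                     (∀ k l → toℕ k < toℕ l → R (lookup xs k) (lookup xs l)) → AllPairs R xs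
  AllPairs-lookup⁺ []       _        = []
  AllPairs-lookup⁺ (x ∷ xs) R-lookup =
    All-lookup⁺ xs (λ l → R-lookup fzero (fsuc l) z<s) ∷
    AllPairs-lookup⁺ xs (λ k l k<l → R-lookup (fsuc k) (fsuc l) (s<s k<l))

  AllPairs-reverse⁺ : ∀ {R : A → A → Set} {xs} → AllPairs R xs → AllPairs (flip R) (reverse xs)
  AllPairs-reverse⁺ {xs = []}     []          = []
  AllPairs-reverse⁺ {xs = x ∷ xs} (Rx ∷ Rxs) rewrite unfold-reverse x xs =
    AllPairs.++⁺ (AllPairs-reverse⁺ Rxs) ([] ∷ []) (All-reverse⁺ (All.map (_∷ []) Rx))

downward-induction : ∀ (P : ℕ → Set) {b} → P b → (∀ {c} → c < b → P (suc c) → P c) → ∀ {c} → c ≤ b → P c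
downward-induction P {b} Pb step c≤b = go (≤⇒≤‴ c≤b)
  where
  go : ∀ {c} → c ≤‴ b → P c
  go ≤‴-refl            = Pb
  go (≤‴-step 1+c≤‴b) = step (≤‴⇒≤ 1+c≤‴b) (go 1+c≤‴b)

plus? : (s : Sym) → Dec (s ≡ plus)
plus? zer  = no (λ ())
plus? plus = yes refl

choose : Sym → ℕ → ℕ → ℕ
choose zer  x y = x
choose plus x y = y

-- fromAbove r c and fromRight r c are the values entering box (r , c) from above and from
-- the right once all boxes above or to the right of it are processed; fromAbove 0 c is junk,
-- and the fuel of fromRightFuel is the number of columns to the right.
module Pipes (a : ℕ) (D : Box → Sym) where

  mutual
    fromAbove : ℕ → ℕ → ℕ
    fromAbove zero          c = 0
    fromAbove (suc zero)    c = c ∸ 1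
    fromAbove (suc (suc r)) c = choose (D (suc r , c)) (fromAbove (suc r) c) (fromRightFuel (suc r) c (a ∸ c))

    fromRightFuel : ℕ → ℕ → ℕ → ℕ
    fromRightFuel r c zero    = a + r ∸ 1
    fromRightFuel r c (suc k) = choose (D (r , suc c)) (fromRightFuel r (suc c) k) (fromAbove r (suc c))

  fromRight : ℕ → ℕ → ℕ
  fromRight r c = fromRightFuel r c (a ∸ c)

  fromRight-step : ∀ r c → c < a → fromRight r c ≡ choose (D (r , suc c)) (fromRight r (suc c)) (fromAbove r (suc c))
  fromRight-step r c c<a rewrite +-∸-assoc 1 c<a = refl

  fromRight-border : ∀ m → fromRight (suc m) a ≡ a + m
  fromRight-border m rewrite n∸n≡0 a | +-suc a m = refl

  fromRight-≤ : ∀ m → (∀ c → 1 ≤ c → c ≤ a → fromAbove (suc m) c < a + m) →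
                ∀ {c} → c ≤ a → fromRight (suc m) c ≤ a + m
  fromRight-≤ m fromAbove< = downward-induction (λ c → fromRight (suc m) c ≤ a + m) (≤-reflexive (fromRight-border m)) step
    where
    step : ∀ {c} → c < a → fromRight (suc m) (suc c) ≤ a + m → fromRight (suc m) c ≤ a + m
    step {c} c<a ih rewrite fromRight-step (suc m) c c<a with D (suc m , suc c)
    ... | zer  = ih
    ... | plus = <⇒≤ (fromAbove< (suc c) z<s c<a)

  fromAbove-< : ∀ m c → 1 ≤ c → c ≤ a → fromAbove (suc m) c < a + m
  fromAbove-< zero    c 1≤c c≤a = subst (c ∸ 1 <_) (sym (+-identityʳ a)) (∸-monoˡ-< (s≤s c≤a) 1≤c)
  fromAbove-< (suc m) c 1≤c c≤a with D (suc m , c)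
  ... | zer  = <-trans (fromAbove-< m c 1≤c c≤a) (subst (a + m <_) (sym (+-suc a m)) (n<1+n _))
  ... | plus = subst (fromRight (suc m) c <_) (sym (+-suc a m)) (s≤s (fromRight-≤ m (fromAbove-< m) c≤a))

  ZeroRightOfPlus : ℕ → ℕ → Set
  ZeroRightOfPlus m c = ∃₂ λ r c′ → 1 ≤ r × r ≤ m × 1 ≤ c′ × c′ < c × D (r , c) ≡ zer × D (r , c′) ≡ plus

  Forbidden : ℕ → Set
  Forbidden m = ∃₂ λ r c → r < m × c ≤ a × ZeroRightOfPlus r c × D (suc r , c) ≡ plus

  Good : ℕ → ℕ → Set
  Good r c = fromAbove r c < fromRight r c

  AllGood : ℕ → Set
  AllGood m = ∀ r c → 1 ≤ r → r ≤ m → 1 ≤ c → c ≤ a → Good r c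

  RowInvariant : ℕ → Set
  RowInvariant m = ∀ p → 1 ≤ p → p ≤ a →
    (ZeroRightOfPlus m p → ∃ λ c → 1 ≤ c × c < p × fromAbove (suc m) p < fromAbove (suc m) c) ×
    (¬ ZeroRightOfPlus m p → ∀ c → 1 ≤ c → c < p → fromAbove (suc m) c < fromAbove (suc m) p)

  ZeroRightOfPlus-suc : ∀ {m c} → ZeroRightOfPlus m c → ZeroRightOfPlus (suc m) c
  ZeroRightOfPlus-suc (r , c′ , 1≤r , r≤m , rest) = r , c′ , 1≤r , m≤n⇒m≤1+n r≤m , rest

  module Row (m : ℕ) where

    t R : ℕ → ℕ
    t = fromAbove (suc m)
    R = fromRight (suc m)

    d : ℕ → Sym
    d c = D (suc m , c)

    fromRight-≤-plus : (∀ c → 1 ≤ c → c ≤ a → Good (suc m) c) →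
                       ∀ {p} → d p ≡ plus → p ≤ a → ∀ {c} → c < p → R c ≤ t p
    fromRight-≤-plus good {suc p} dp≡+ p≤a (s≤s c≤p) = downward-induction (λ c → R c ≤ t (suc p)) base step c≤p
      where
      base : R p ≤ t (suc p)
      base rewrite fromRight-step (suc m) p p≤a | dp≡+ = ≤-refl
      step : ∀ {c} → c < p → R (suc c) ≤ t (suc p) → R c ≤ t (suc p)
      step {c} c<p ih rewrite fromRight-step (suc m) c (<-trans c<p p≤a) with d (suc c)
      ... | zer  = ih
      ... | plus = <⇒≤ (<-≤-trans (good (suc c) z<s (<-trans c<p p≤a)) ih)

    IncreasingBeforePluses : Set
    IncreasingBeforePluses = ∀ q → 1 ≤ q → q ≤ a → d q ≡ plus → ∀ c → 1 ≤ c → c < q → t c < t q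

    module _ (increasing : IncreasingBeforePluses) where

      fromAbove<fromRight : ∀ {p c} → 1 ≤ p → p ≤ c → c ≤ a → t p < R c
      fromAbove<fromRight {p} 1≤p p≤c c≤a =
        downward-induction (λ c → p ≤ c → t p < R c) border step c≤a p≤c
        where
        border : p ≤ a → t p < R a
        border p≤a = subst (t p <_) (sym (fromRight-border m)) (fromAbove-< m p 1≤p p≤a)
        step : ∀ {c} → c < a → (p ≤ suc c → t p < R (suc c)) → p ≤ c → t p < R c
        step {c} c<a ih p≤c rewrite fromRight-step (suc m) c c<a with d (suc c) in dc+1
        ... | zer  = ih (m≤n⇒m≤1+n p≤c)
        ... | plus = increasing (suc c) z<s c<a dc+1 p 1≤p (s≤s p≤c)

      fromRight-<-plus : ∀ {p} → d p ≡ plus → p ≤ a → ∀ {c} → c < p → R c < R p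
      fromRight-<-plus {suc p} dp≡+ p≤a (s≤s c≤p) = downward-induction (λ c → R c < R (suc p)) base step c≤p
        where
        base : R p < R (suc p)
        base rewrite fromRight-step (suc m) p p≤a | dp≡+ = fromAbove<fromRight z<s ≤-refl p≤a
        step : ∀ {c} → c < p → R (suc c) < R (suc p) → R c < R (suc p)
        step {c} c<p ih rewrite fromRight-step (suc m) c (<-trans c<p p≤a) with d (suc c)
        ... | zer  = ih
        ... | plus = fromAbove<fromRight z<s (s≤s (<⇒≤ c<p)) p≤a

      fromAbove<fromRight-left-of-zero : ∀ {p} → d p ≡ zer → p ≤ a → ∀ {c} → c < p →
                       t p < R c ⊎ ∃ λ c′ → c < c′ × c′ < p × d c′ ≡ plus × t p < R c′
      fromAbove<fromRight-left-of-zero {suc p} dp≡0 p≤a (s≤s c≤p) = downward-induction Seen base step c≤p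
        where
        Seen : ℕ → Set
        Seen c = t (suc p) < R c ⊎ ∃ λ c′ → c < c′ × c′ < suc p × d c′ ≡ plus × t (suc p) < R c′
        base : Seen p
        base rewrite fromRight-step (suc m) p p≤a | dp≡0 = inj₁ (fromAbove<fromRight z<s ≤-refl p≤a)
        step : ∀ {c} → c < p → Seen (suc c) → Seen c
        step {c} c<p (inj₁ tp<Rc+1) rewrite fromRight-step (suc m) c (<-trans c<p p≤a) with d (suc c) in dc+1
        ... | zer  = inj₁ tp<Rc+1
        ... | plus = inj₂ (suc c , ≤-refl , s≤s c<p , dc+1 , tp<Rc+1)
        step c<p (inj₂ (c′ , c+1<c′ , rest)) = inj₂ (c′ , <-trans (n<1+n _) c+1<c′ , rest)

    increasing : ¬ Forbidden (suc m) → RowInvariant m → IncreasingBeforePluses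
    increasing ¬forbidden inv q 1≤q q≤a dq≡+ =
      proj₂ (inv q 1≤q q≤a) (λ zrp → ¬forbidden (m , q , ≤-refl , q≤a , zrp , dq≡+))

    private
      t′ : ℕ → ℕ
      t′ = fromAbove (suc (suc m))

      t′-zer : ∀ {c} → d c ≡ zer → t′ c ≡ t c
      t′-zer {c} dc≡0 = cong (λ s → choose s (t c) (R c)) dc≡0

      t′-plus : ∀ {c} → d c ≡ plus → t′ c ≡ R c
      t′-plus {c} dc≡+ = cong (λ s → choose s (t c) (R c)) dc≡+

    invariant-step : ¬ Forbidden (suc m) → RowInvariant m → RowInvariant (suc m)
    invariant-step ¬forbidden inv p 1≤p p≤a = descent , ascent
      where
      inc : IncreasingBeforePluses
      inc = increasing ¬forbidden inv

      plusBefore? : Dec (∃ λ c → c < p × (1 ≤ c × d c ≡ plus))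
      plusBefore? = anyUpTo? (λ c → (1 ≤? c) ×-dec plus? (d c)) p

      descent : ZeroRightOfPlus (suc m) p → ∃ λ c → 1 ≤ c × c < p × t′ p < t′ c
      descent (r , c′ , 1≤r , r≤m+1 , 1≤c′ , c′<p , drp≡0 , drc′≡+) with d p in dp | plusBefore?
      ... | plus | _ with m≤n⇒m<n∨m≡n r≤m+1
      ...   | inj₂ refl with () ← trans (sym drp≡0) dp
      ...   | inj₁ (s≤s r≤m) = ⊥-elim (¬forbidden (m , p , ≤-refl , p≤a , (r , c′ , 1≤r , r≤m , 1≤c′ , c′<p , drp≡0 , drc′≡+) , dp))
      descent _ | zer | yes (c₁ , c₁<p , 1≤c₁ , dc₁≡+) with fromAbove<fromRight-left-of-zero inc dp p≤a c₁<p
      ... | inj₁ tp<Rc₁ = c₁ , 1≤c₁ , c₁<p , subst (t p <_) (sym (t′-plus dc₁≡+)) tp<Rc₁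
      ... | inj₂ (c₂ , c₁<c₂ , c₂<p , dc₂≡+ , tp<Rc₂) =
        c₂ , ≤-trans 1≤c₁ (<⇒≤ c₁<c₂) , c₂<p , subst (t p <_) (sym (t′-plus dc₂≡+)) tp<Rc₂
      descent (r , c′ , 1≤r , r≤m+1 , 1≤c′ , c′<p , drp≡0 , drc′≡+) | zer | no noPlus with m≤n⇒m<n∨m≡n r≤m+1
      ... | inj₂ refl       = ⊥-elim (noPlus (c′ , c′<p , 1≤c′ , drc′≡+))
      ... | inj₁ (s≤s r≤m) with proj₁ (inv p 1≤p p≤a) (r , c′ , 1≤r , r≤m , 1≤c′ , c′<p , drp≡0 , drc′≡+)
      ...   | c , 1≤c , c<p , tp<tc = c , 1≤c , c<p , subst (t p <_) (sym (t′-zer dc≡0)) tp<tc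
        where
        dc≡0 : d c ≡ zer
        dc≡0 with d c in dc
        ... | zer  = refl
        ... | plus = ⊥-elim (noPlus (c , c<p , 1≤c , dc))

      ascent : ¬ ZeroRightOfPlus (suc m) p → ∀ c → 1 ≤ c → c < p → t′ c < t′ p
      ascent ¬zrp c 1≤c c<p with d p in dp | d c in dc
      ... | plus | zer  = fromAbove<fromRight inc 1≤c (<⇒≤ c<p) p≤a
      ... | plus | plus = fromRight-<-plus inc dp p≤a c<p
      ... | zer  | zer  = proj₂ (inv p 1≤p p≤a) (¬zrp ∘ ZeroRightOfPlus-suc) c 1≤c c<p
      ... | zer  | plus = ⊥-elim (¬zrp (suc m , c , z<s , ≤-refl , 1≤c , c<p , dp , dc))

  Forbidden-mono : ∀ {m m′} → m ≤ m′ → Forbidden m → Forbidden m′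
  Forbidden-mono m≤m′ (r , c , r<m , rest) = r , c , <-≤-trans r<m m≤m′ , rest

  AllGood-mono : ∀ {m m′} → m ≤ m′ → AllGood m′ → AllGood m
  AllGood-mono m≤m′ good r c 1≤r r≤m = good r c 1≤r (≤-trans r≤m m≤m′)

  rowInvariant : ∀ m → ¬ Forbidden m → RowInvariant m
  rowInvariant zero    _          p 1≤p p≤a =
    (λ { (r , _ , 1≤r , r≤0 , _) → ⊥-elim (<-irrefl refl (≤-trans 1≤r r≤0)) }) ,
    (λ _ c 1≤c c<p → ∸-monoˡ-< c<p 1≤c)
  rowInvariant (suc m) ¬forbidden =
    Row.invariant-step m ¬forbidden (rowInvariant m (¬forbidden ∘ Forbidden-mono (n≤1+n m)))

  ¬Forbidden⇒AllGood : ∀ m → ¬ Forbidden m → AllGood m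
  ¬Forbidden⇒AllGood m ¬forbidden (suc r) c _ r<m 1≤c c≤a =
    Row.fromAbove<fromRight r (Row.increasing r ¬forbidden′ (rowInvariant r (¬forbidden′ ∘ Forbidden-mono (n≤1+n r))))
      1≤c ≤-refl c≤a
    where
    ¬forbidden′ : ¬ Forbidden (suc r)
    ¬forbidden′ = ¬forbidden ∘ Forbidden-mono r<m

  AllGood⇒¬Forbidden : ∀ m → AllGood m → ¬ Forbidden m
  AllGood⇒¬Forbidden (suc m) good (r , c , r<m+1 , c≤a , zrp , dc≡+) with m≤n⇒m<n∨m≡n (≤-pred r<m+1)
  ... | inj₁ r<m = AllGood⇒¬Forbidden m (AllGood-mono (n≤1+n m) good) (r , c , r<m , c≤a , zrp , dc≡+)
  ... | inj₂ refl with proj₁ (rowInvariant r (AllGood⇒¬Forbidden r (AllGood-mono (n≤1+n r) good)) c 1≤c c≤a) zrp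
    where
    1≤c : 1 ≤ c
    1≤c = let (_ , _ , _ , _ , 1≤c′ , c′<c , _) = zrp in ≤-trans 1≤c′ (<⇒≤ c′<c)
  ...   | c₀ , 1≤c₀ , c₀<c , tc<tc₀ = <-asym tc<tc₀ (<-≤-trans (rowGood c₀ 1≤c₀ (<⇒≤ (<-≤-trans c₀<c c≤a)))
                                                           (Row.fromRight-≤-plus r rowGood dc≡+ c≤a c₀<c))
    where
    rowGood : ∀ c → 1 ≤ c → c ≤ a → Good (suc r) c
    rowGood c 1≤c c≤a = good (suc r) c z<s ≤-refl 1≤c c≤a

  AllGood⇔¬Forbidden : ∀ m → AllGood m ⇔ (¬ Forbidden m)
  AllGood⇔¬Forbidden m = mk⇔ (AllGood⇒¬Forbidden m) (¬Forbidden⇒AllGood m)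

module Grid (n j : ℕ) where

  ≤Q-rightward : ∀ {r c c′} → InQ n j (r , c) → c′ ≤ n ∸ j → c ≤ c′ → (r , c) ≤[ n , j ]Q (r , c′)
  ≤Q-rightward {r} {c′ = c′} q c′≤a c≤c′ = go q (≤⇒≤‴ c≤c′)
    where
    go : ∀ {c} → InQ n j (r , c) → c ≤‴ c′ → (r , c) ≤[ n , j ]Q (r , c′)
    go q ≤‴-refl = ε
    go {c} q@(1≤r , r≤j , _ , _) (≤‴-step c<‴c′) = right q q′ ◅ go q′ c<‴c′
      where
      q′ : InQ n j (r , suc c)
      q′ = 1≤r , r≤j , z<s , ≤-trans (≤‴⇒≤ c<‴c′) c′≤a

  ≤Q-upward : ∀ {r r′ c} → InQ n j (r , c) → 1 ≤ r′ → r′ ≤ r → (r , c) ≤[ n , j ]Q (r′ , c)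
  ≤Q-upward {r} {c = c} (_ , r≤j , 1≤c , c≤a) 1≤r′ r′≤r = go 1≤r′ (≤⇒≤‴ r′≤r)
    where
    go : ∀ {r′} → 1 ≤ r′ → r′ ≤‴ r → (r , c) ≤[ n , j ]Q (r′ , c)
    go _     ≤‴-refl            = ε
    go {r′} 1≤r′ (≤‴-step r′<‴r) = go z<s r′<‴r ◅◅ (up q q′ ◅ ε)
      where
      q : InQ n j (suc r′ , c)
      q = z<s , ≤-trans (≤‴⇒≤ r′<‴r) r≤j , 1≤c , c≤a
      q′ : InQ n j (r′ , c)
      q′ = 1≤r′ , ≤-trans (n≤1+n _) (≤-trans (≤‴⇒≤ r′<‴r) r≤j) , 1≤c , c≤a

  ≤Q-intro : ∀ {r₁ c₁ r₂ c₂} → InQ n j (r₁ , c₁) → InQ n j (r₂ , c₂) → r₂ ≤ r₁ → c₁ ≤ c₂ →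
             (r₁ , c₁) ≤[ n , j ]Q (r₂ , c₂)
  ≤Q-intro q₁@(1≤r₁ , r₁≤j , _ , _) (1≤r₂ , _ , 1≤c₂ , c₂≤a) r₂≤r₁ c₁≤c₂ =
    ≤Q-rightward q₁ c₂≤a c₁≤c₂ ◅◅ ≤Q-upward (1≤r₁ , r₁≤j , 1≤c₂ , c₂≤a) 1≤r₂ r₂≤r₁

orPlus : (x : Bool) → (T x → Sym) → Sym
orPlus true  d = d tt
orPlus false _ = plus

orPlus-T : ∀ x (d : T x → Sym) (p : T x) → orPlus x d ≡ d p
orPlus-T true d tt = refl

orPlus-¬T : ∀ x (d : T x → Sym) → ¬ T x → orPlus x d ≡ plus
orPlus-¬T true  d ¬p = ⊥-elim (¬p tt)
orPlus-¬T false d ¬p = refl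

orPlus-zer⇒T : ∀ x (d : T x → Sym) → orPlus x d ≡ zer → T x
orPlus-zer⇒T true d _ = tt

+≡+-trichotomy : ∀ {x y u v} → x + y ≡ u + v → (x < u × v < y) ⊎ (x ≡ u × y ≡ v) ⊎ (u < x × y < v)
+≡+-trichotomy {x} {y} {u} {v} eq with <-cmp x u
... | tri< x<u _ _ = inj₁ (x<u , +-cancelˡ-< x v y (subst (x + v <_) (sym eq) (+-monoˡ-< v x<u)))
... | tri≈ _ refl _ = inj₂ (inj₁ (refl , +-cancelˡ-≡ x y v eq))
... | tri> _ _ u<x = inj₂ (inj₂ (u<x , +-cancelˡ-< u y v (subst (u + y <_) eq (+-monoˡ-< y u<x))))

module Simulation (n j : ℕ) (j≤n : j ≤ n) (O : Shape) (D : Diagram O) (OI : IsOrderIdeal n j O) where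

  a : ℕ
  a = n ∸ j

  D⁺ : Box → Sym
  D⁺ b = orPlus (O b) (D b)

  D⁺≡D : ∀ {x} (p : x ∈O O) → D⁺ x ≡ D x p
  D⁺≡D {x} = orPlus-T (O x) (D x)

  open Pipes a D⁺ public
  open Grid n j

  DownClosed : (Box → Set) → Set
  DownClosed U = ∀ x y → InQ n j y → U x → y ≤[ n , j ]Q x → U y

  private
    O⊆Q : ∀ x → x ∈O O → InQ n j x
    O⊆Q = proj₁ OI

    O-down : DownClosed (_∈O O)
    O-down x y y∈Q x∈O y≤x = proj₂ OI y x y∈Q x∈O y≤x

  afterLetter : Sym → ℕ → Perm → Perm
  afterLetter zer  i v = rmulS i v
  afterLetter plus i v = v

  PDS-∷⇔ : ∀ v b p bs → PDS n O D v ((b , p) ∷ bs) ⇔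
           ((v <[ n ]B rmulS (label b) v) × PDS n O D (afterLetter (D b p) (label b) v) bs)
  PDS-∷⇔ v b p bs with D b p
  ... | zer  = ⇔.refl
  ... | plus = ⇔.refl

  -- horizontal ρ c separates the boxes (ρ , c+1) and (ρ+1 , c+1), vertical r c the boxes
  -- (r+1 , c) and (r+1 , c+1); the value travelling along an edge sits at its position in v.
  data Edge : Set where
    horizontal vertical : ℕ → ℕ → Edge

  position : Edge → ℕ
  position (horizontal ρ c) = ρ + c
  position (vertical r c)   = r + c

  value : Edge → ℕ
  value (horizontal ρ c) = fromAbove (suc ρ) (suc c)
  value (vertical r c)   = fromRight (suc r) c

  OnBoundary : (Box → Set) → Edge → Set
  OnBoundary U (horizontal ρ c) = suc c ≤ a × (ρ ≡ j ⊎ U (suc ρ , suc c)) × ¬ U (ρ , suc c)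
  OnBoundary U (vertical r c)   = suc r ≤ j × c ≤ a × (c ≡ 0 ⊎ U (suc r , c)) × ¬ U (suc r , suc c)

  -- Tracks f U is the invariant of v = applyUpTo f n once exactly the boxes outside U are processed.
  Tracks : (ℕ → ℕ) → (Box → Set) → Set
  Tracks f U = ∀ e → OnBoundary U e → f (position e) ≡ value e

  -- Removing a maximal box b from U replaces the edges above and to the right of b on the
  -- boundary by those to the left and below, on the same antidiagonals L and L+1.
  module Removal (U : Box → Set) (U⊆Q : ∀ x → U x → InQ n j x)
                 (U-down : DownClosed U)
                 (r₀ c₀ : ℕ) (b∈U : U (suc r₀ , suc c₀))
                 (b-maximal : ∀ x → U x → ¬ ((suc r₀ , suc c₀) <[ n , j ]Q x)) where

    b : Box
    b = (suc r₀ , suc c₀)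

    U′ : Box → Set
    U′ x = U x × x ≢ b

    L : ℕ
    L = r₀ + c₀

    r₀<j : suc r₀ ≤ j
    r₀<j = proj₁ (proj₂ (U⊆Q b b∈U))

    c₀<a : suc c₀ ≤ a
    c₀<a = proj₂ (proj₂ (proj₂ (U⊆Q b b∈U)))

    label-b : label b ≡ suc L
    label-b = +-suc r₀ c₀

    L+1<n : suc L < n
    L+1<n = begin-strict
      suc L        ≡⟨ label-b ⟨
      r₀ + suc c₀  <⟨ +-monoˡ-< (suc c₀) r₀<j ⟩
      j + suc c₀   ≤⟨ +-monoʳ-≤ j c₀<a ⟩
      j + (n ∸ j)  ≡⟨ m+[n∸m]≡n j≤n ⟩
      n            ∎
      where open ≤-Reasoning

    ∉U′-above-right : ∀ {x y} → x ≤ suc r₀ → suc c₀ ≤ y → ¬ U′ (x , y)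
    ∉U′-above-right x≤r y>c₀ (u , x,y≢b) =
      b-maximal _ u (≤Q-intro (U⊆Q b b∈U) (U⊆Q _ u) x≤r y>c₀ , x,y≢b ∘ sym)

    ∈U′-below-left : ∀ {x y} → suc r₀ ≤ x → x ≤ j → 1 ≤ y → y ≤ suc c₀ → (x , y) ≢ b → U′ (x , y)
    ∈U′-below-left {x} {y} x>r₀ x≤j 1≤y y≤c = U-down b _ q b∈U (≤Q-intro q (U⊆Q b b∈U) x>r₀ y≤c) ,_
      where
      q : InQ n j (x , y)
      q = ≤-trans (s≤s z≤n) x>r₀ , x≤j , 1≤y , ≤-trans y≤c c₀<a

    private
      row-≤ : ∀ {ρ y} → ρ ≡ j ⊎ U′ (suc ρ , y) → ρ ≤ j
      row-≤ (inj₁ refl)     = ≤-refl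
      row-≤ (inj₂ (u , _)) = ≤-trans (n≤1+n _) (proj₁ (proj₂ (U⊆Q _ u)))

      not-bottom : ∀ {ρ y} → ρ ≤ r₀ → ρ ≡ j ⊎ U′ (suc ρ , y) → U′ (suc ρ , y)
      not-bottom ρ≤r₀ (inj₁ refl) = ⊥-elim (<-irrefl refl (≤-trans (s≤s ρ≤r₀) r₀<j))
      not-bottom _    (inj₂ u)    = u

      not-left : ∀ {x c} → c₀ < c → c ≡ 0 ⊎ U′ (x , c) → U′ (x , c)
      not-left () (inj₁ refl)
      not-left _  (inj₂ u) = u

      ≢-row : ∀ {x y x′ y′ : ℕ} → x ≢ x′ → (x , y) ≢ (x′ , y′)
      ≢-row x≢x′ refl = x≢x′ refl

      ≢-col : ∀ {x y x′ y′ : ℕ} → y ≢ y′ → (x , y) ≢ (x′ , y′)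
      ≢-col y≢y′ refl = y≢y′ refl

    boundary-at-L : ∀ e → OnBoundary U′ e → position e ≡ L → e ≡ vertical r₀ c₀
    boundary-at-L (horizontal ρ c) (_ , below , ¬above) eq with +≡+-trichotomy eq
    ... | inj₁ (ρ<r₀ , c₀<c)       = ⊥-elim (∉U′-above-right (s≤s (<⇒≤ ρ<r₀)) (s≤s (<⇒≤ c₀<c)) (not-bottom (<⇒≤ ρ<r₀) below))
    ... | inj₂ (inj₁ (refl , refl)) = ⊥-elim (proj₂ (not-bottom ≤-refl below) refl)
    ... | inj₂ (inj₂ (r₀<ρ , c<c₀)) =
      ⊥-elim (¬above (∈U′-below-left r₀<ρ (row-≤ below) (s≤s z≤n) (s≤s (<⇒≤ c<c₀)) (≢-col (<⇒≢ (s≤s c<c₀)))))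
    boundary-at-L (vertical r c) (r<j , _ , left , ¬right) eq with +≡+-trichotomy eq
    ... | inj₁ (r<r₀ , c₀<c)       = ⊥-elim (∉U′-above-right (s≤s (<⇒≤ r<r₀)) c₀<c (not-left c₀<c left))
    ... | inj₂ (inj₁ (refl , refl)) = refl
    ... | inj₂ (inj₂ (r₀<r , c<c₀)) =
      ⊥-elim (¬right (∈U′-below-left (s≤s (<⇒≤ r₀<r)) r<j (s≤s z≤n) (s≤s (<⇒≤ c<c₀)) (≢-row (≢-sym (<⇒≢ (s≤s r₀<r))))))

    boundary-at-L+1 : ∀ e → OnBoundary U′ e → position e ≡ suc L → e ≡ horizontal (suc r₀) c₀
    boundary-at-L+1 (horizontal ρ c) (_ , below , ¬above) eq with +≡+-trichotomy eq
    ... | inj₁ (ρ≤r₀ , c₀<c)         = ⊥-elim (∉U′-above-right ρ≤r₀ (s≤s (<⇒≤ c₀<c)) (not-bottom (≤-pred ρ≤r₀) below))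
    ... | inj₂ (inj₁ (refl , refl))   = refl
    ... | inj₂ (inj₂ (r₀+1<ρ , c<c₀)) =
      ⊥-elim (¬above (∈U′-below-left (<⇒≤ r₀+1<ρ) (row-≤ below) (s≤s z≤n) (s≤s (<⇒≤ c<c₀)) (≢-col (<⇒≢ (s≤s c<c₀)))))
    boundary-at-L+1 (vertical r c) (r<j , _ , left , ¬right) eq with +≡+-trichotomy eq
    ... | inj₁ (r≤r₀ , c₀<c)         = ⊥-elim (∉U′-above-right r≤r₀ c₀<c (not-left c₀<c left))
    ... | inj₂ (inj₁ (refl , refl))   =
      ⊥-elim (¬right (∈U′-below-left (n≤1+n _) r<j (s≤s z≤n) ≤-refl (≢-row (≢-sym (<⇒≢ (n<1+n _))))))
    ... | inj₂ (inj₂ (r₀+1<r , c<c₀)) =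
      ⊥-elim (¬right (∈U′-below-left (m≤n⇒m≤1+n (<⇒≤ r₀+1<r)) r<j (s≤s z≤n) (s≤s (<⇒≤ c<c₀))
                                      (≢-row (≢-sym (<⇒≢ (<-trans (n<1+n _) (s≤s r₀+1<r)))))))

    boundary-elsewhere : ∀ e → OnBoundary U′ e → position e ≢ L → position e ≢ suc L → OnBoundary U e
    boundary-elsewhere (horizontal ρ c) (c<a , below , ¬above) _ pos≢L+1 =
      c<a , map₂ proj₁ below , λ u → ¬above (u , λ { refl → pos≢L+1 refl })
    boundary-elsewhere (vertical r c) (r<j , c≤a , left , ¬right) pos≢L _ =
      r<j , c≤a , map₂ proj₁ left , λ u → ¬right (u , λ { refl → pos≢L refl })

    top-on-boundary : OnBoundary U (horizontal r₀ c₀)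
    top-on-boundary = c₀<a , inj₂ b∈U , λ u → ∉U′-above-right (n≤1+n _) ≤-refl (u , ≢-row (<⇒≢ (n<1+n _)))

    right-on-boundary : OnBoundary U (vertical r₀ (suc c₀))
    right-on-boundary = r₀<j , c₀<a , inj₂ b∈U , λ u → ∉U′-above-right ≤-refl (n≤1+n _) (u , ≢-col (≢-sym (<⇒≢ (n<1+n _))))

    afterBox : Sym → (ℕ → ℕ) → ℕ → ℕ
    afterBox zer  f = f ∘ τ L (suc L)
    afterBox plus f = f

    afterLetter-applyUpTo : ∀ s f → afterLetter s (label b) (applyUpTo f n) ≡ applyUpTo (afterBox s f) n
    afterLetter-applyUpTo zer  f rewrite label-b = rmulS-applyUpTo f n L L+1<n
    afterLetter-applyUpTo plus f = refl

    module _ (f : ℕ → ℕ) (tracks : Tracks f U) where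

      top≡ : f L ≡ fromAbove (suc r₀) (suc c₀)
      top≡ = tracks (horizontal r₀ c₀) top-on-boundary

      right≡ : f (suc L) ≡ fromRight (suc r₀) (suc c₀)
      right≡ = trans (cong f (sym (+-suc r₀ c₀))) (tracks (vertical r₀ (suc c₀)) right-on-boundary)

      <B-rmulS⇔Good : (applyUpTo f n <[ n ]B rmulS (label b) (applyUpTo f n)) ⇔ Good (suc r₀) (suc c₀)
      <B-rmulS⇔Good rewrite label-b =
        ⇔.trans (<B-rmulS⇔ f n L L+1<n) (subst₂ (λ x y → (f L < f (suc L)) ⇔ (x < y)) top≡ right≡ ⇔.refl)

      tracks-afterBox : Tracks (afterBox (D⁺ b) f) U′
      tracks-afterBox e e∈∂U′ with position e ≟ L | position e ≟ suc L
      ... | yes pos≡L | _ with boundary-at-L e e∈∂U′ pos≡L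
      ...   | refl = trans left≡ (sym (fromRight-step (suc r₀) c₀ c₀<a))
        where
        left≡ : afterBox (D⁺ b) f L ≡ choose (D⁺ b) (fromRight (suc r₀) (suc c₀)) (fromAbove (suc r₀) (suc c₀))
        left≡ with D⁺ b
        ... | zer  = trans (cong f (τ-fst L (suc L))) right≡
        ... | plus = top≡
      tracks-afterBox e e∈∂U′ | no _ | yes pos≡L+1 with boundary-at-L+1 e e∈∂U′ pos≡L+1
      ...   | refl = bottom≡
        where
        bottom≡ : afterBox (D⁺ b) f (suc L) ≡ choose (D⁺ b) (fromAbove (suc r₀) (suc c₀)) (fromRight (suc r₀) (suc c₀))
        bottom≡ with D⁺ b
        ... | zer  = trans (cong f (τ-snd L (suc L) (<⇒≢ (n<1+n L)))) top≡
        ... | plus = right≡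
      tracks-afterBox e e∈∂U′ | no pos≢L | no pos≢L+1 =
        trans elsewhere (tracks e (boundary-elsewhere e e∈∂U′ pos≢L pos≢L+1))
        where
        elsewhere : afterBox (D⁺ b) f (position e) ≡ f (position e)
        elsewhere with D⁺ b
        ... | zer  = cong f (τ-other L (suc L) _ pos≢L pos≢L+1)
        ... | plus = refl

  ∉O-right : ∀ {r c} → 1 ≤ c → ¬ (r , c) ∈O O → ¬ (r , suc c) ∈O O
  ∉O-right {r} {c} 1≤c ¬p p with O⊆Q _ p
  ... | 1≤r , r≤j , _ , c<a = ¬p (O-down _ _ q p (≤Q-rightward q c<a (n≤1+n _)))
    where
    q : InQ n j (r , c)
    q = 1≤r , r≤j , 1≤c , <⇒≤ c<a

  ∉O-up : ∀ {r c} → suc r ≤ j → 1 ≤ c → c ≤ a → ¬ (suc r , c) ∈O O → ¬ (r , c) ∈O O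
  ∉O-up {r} {c} r<j 1≤c c≤a ¬p p with O⊆Q _ p
  ... | 1≤r , _ = ¬p (O-down _ _ q p (≤Q-upward q 1≤r (n≤1+n _)))
    where
    q : InQ n j (suc r , c)
    q = z<s , r<j , 1≤c , c≤a

  D⁺-outside : ∀ {x} → ¬ x ∈O O → D⁺ x ≡ plus
  D⁺-outside {x} = orPlus-¬T (O x) (D x)

  mutual
    fromAbove-outside : ∀ ρ c → ρ ≤ j → suc c ≤ a → ¬ (ρ , suc c) ∈O O → fromAbove (suc ρ) (suc c) ≡ ρ + c
    fromAbove-outside zero    c _   _   _  = refl
    fromAbove-outside (suc ρ) c ρ<j c<a ¬p = begin
      choose (D⁺ (suc ρ , suc c)) (fromAbove (suc ρ) (suc c)) (fromRight (suc ρ) (suc c))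
        ≡⟨ cong (λ s → choose s (fromAbove (suc ρ) (suc c)) (fromRight (suc ρ) (suc c))) (D⁺-outside ¬p) ⟩
      fromRight (suc ρ) (suc c)
        ≡⟨ fromRight-outside ρ (suc c) ρ<j c<a (∉O-right z<s ¬p) ⟩
      ρ + suc c
        ≡⟨ +-suc ρ c ⟩
      suc ρ + c ∎
      where open ≡-Reasoning

    fromRight-outside : ∀ r c → suc r ≤ j → c ≤ a → ¬ (suc r , suc c) ∈O O → fromRight (suc r) c ≡ r + c
    fromRight-outside r c r<j c≤a ¬p with m≤n⇒m<n∨m≡n c≤a
    ... | inj₂ refl = trans (fromRight-border r) (+-comm a r)
    ... | inj₁ c<a  = begin
      fromRight (suc r) c
        ≡⟨ fromRight-step (suc r) c c<a ⟩
      choose (D⁺ (suc r , suc c)) (fromRight (suc r) (suc c)) (fromAbove (suc r) (suc c))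
        ≡⟨ cong (λ s → choose s (fromRight (suc r) (suc c)) (fromAbove (suc r) (suc c))) (D⁺-outside ¬p) ⟩
      fromAbove (suc r) (suc c)
        ≡⟨ fromAbove-outside r c (<⇒≤ r<j) c<a (∉O-up r<j z<s c<a ¬p) ⟩
      r + c ∎
      where open ≡-Reasoning

  Tracks-resp : ∀ {f U V} → (∀ x → U x → V x) → (∀ x → V x → U x) → Tracks f U → Tracks f V
  Tracks-resp U⊆V V⊆U tracks (horizontal ρ c) (c<a , below , ¬above) =
    tracks (horizontal ρ c) (c<a , map₂ (V⊆U _) below , ¬above ∘ U⊆V _)
  Tracks-resp U⊆V V⊆U tracks (vertical r c) (r<j , c≤a , left , ¬right) =
    tracks (vertical r c) (r<j , c≤a , map₂ (V⊆U _) left , ¬right ∘ U⊆V _)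

  tracks-initial : Tracks id (_∈O O)
  tracks-initial (horizontal ρ c) (c<a , below , ¬above) = sym (fromAbove-outside ρ c (row-≤ below) c<a ¬above)
    where
    row-≤ : ρ ≡ j ⊎ (suc ρ , suc c) ∈O O → ρ ≤ j
    row-≤ (inj₁ refl) = ≤-refl
    row-≤ (inj₂ p)   = <⇒≤ (proj₁ (proj₂ (O⊆Q _ p)))
  tracks-initial (vertical r c) (r<j , c≤a , _ , ¬right) = sym (fromRight-outside r c r<j c≤a ¬right)

  Boxes : List (ElemO O) → Box → Set
  Boxes bs x = x ∈ map proj₁ bs

  Boxes⊆O : ∀ {bs x} → Boxes bs x → x ∈O O
  Boxes⊆O {(_ , p) ∷ _} (here refl) = p
  Boxes⊆O {_ ∷ bs}      (there x∈bs) = Boxes⊆O {bs} x∈bs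

  GoodBox : ElemO O → Set
  GoodBox ((r , c) , _) = Good r c

  MaximalFirst : List (ElemO O) → Set
  MaximalFirst = AllPairs (λ e e′ → ¬ (proj₁ e <[ n , j ]Q proj₁ e′))

  PDS⇔All-GoodBox : ∀ bs f → MaximalFirst bs → AllPairs _≢_ (map proj₁ bs) → DownClosed (Boxes bs) →
                    Tracks f (Boxes bs) → PDS n O D (applyUpTo f n) bs ⇔ All GoodBox bs
  PDS⇔All-GoodBox [] f _ _ _ _ = mk⇔ (λ _ → []) (λ _ → tt)
  PDS⇔All-GoodBox (((zero , _) , p) ∷ _) _ _ _ _ _ with () ← proj₁ (O⊆Q _ p)
  PDS⇔All-GoodBox (((suc r₀ , zero) , p) ∷ _) _ _ _ _ _ with () ← proj₁ (proj₂ (proj₂ (O⊆Q _ p)))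
  PDS⇔All-GoodBox (((suc r₀ , suc c₀) , p) ∷ bs) f (b-max ∷ maxs) (b∉bs ∷ uniq) down tracks =
    ⇔.trans (PDS-∷⇔ (applyUpTo f n) b p bs) (⇔.trans (<B-rmulS⇔Good f tracks ×-⇔ rest) (mk⇔ (uncurry _∷_) All.uncons))
    where
    b : Box
    b = (suc r₀ , suc c₀)

    U : Box → Set
    U = Boxes ((b , p) ∷ bs)

    b-maximal : ∀ x → U x → ¬ (b <[ n , j ]Q x)
    b-maximal x (here refl)  (_ , b≢b) = b≢b refl
    b-maximal x (there x∈bs) b<x       = All.lookup (All.map⁺ b-max) x∈bs b<x

    open Removal U (λ x x∈U → O⊆Q x (Boxes⊆O {(b , p) ∷ bs} x∈U)) down r₀ c₀ (here refl) b-maximal hiding (b)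

    down′ : DownClosed (Boxes bs)
    down′ x y y∈Q x∈bs y≤x with down x y y∈Q (there x∈bs) y≤x
    ... | here refl  = ⊥-elim (b-maximal x (there x∈bs) (y≤x , All.lookup b∉bs x∈bs))
    ... | there y∈bs = y∈bs

    tracks′ : Tracks (afterBox (D⁺ b) f) (Boxes bs)
    tracks′ = Tracks-resp {afterBox (D⁺ b) f} {U′} {Boxes bs}
      (λ { x (here refl , x≢b) → ⊥-elim (x≢b refl) ; x (there x∈bs , _) → x∈bs })
      (λ x x∈bs → there x∈bs , ≢-sym (All.lookup b∉bs x∈bs))
      (tracks-afterBox f tracks)

    rest : PDS n O D (afterLetter (D b p) (label b) (applyUpTo f n)) bs ⇔ All GoodBox bs
    rest rewrite sym (D⁺≡D p) | afterLetter-applyUpTo (D⁺ b) f =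
      PDS⇔All-GoodBox bs (afterBox (D⁺ b) f) maxs uniq down′ tracks′

  All-GoodBox⇔AllGood : ∀ bs → (∀ x → x ∈O O → Boxes bs x) → All GoodBox bs ⇔ AllGood j
  All-GoodBox⇔AllGood bs O⊆bs = mk⇔ to from
    where
    to : All GoodBox bs → AllGood j
    to good (suc r) (suc c) _ r<j _ c≤a with T? (O (suc r , suc c))
    ... | yes p = All.lookup (All.map⁺ good) (O⊆bs _ p)
    ... | no ¬p = subst₂ _<_
      (sym (fromAbove-outside r c (<⇒≤ r<j) c≤a (∉O-up r<j z<s c≤a ¬p)))
      (sym (fromRight-outside r (suc c) r<j c≤a (∉O-right z<s ¬p)))
      (+-monoʳ-< r (n<1+n c))
    from : AllGood j → All GoodBox bs
    from good = All.tabulate λ { {(x , p)} _ → let (1≤r , r≤j , 1≤c , c≤a) = O⊆Q x p in good _ _ 1≤r r≤j 1≤c c≤a }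

  IsΓ⇔AllGood : ∀ Ls → IsLinExt n j O Ls → IsΓ n O D Ls ⇔ AllGood j
  IsΓ⇔AllGood Ls (unique , complete , ordered) =
    ⇔.trans (PDS⇔All-GoodBox (reverse Ls) id maximal-first unique′ down tracks) (All-GoodBox⇔AllGood (reverse Ls) O⊆Boxes)
    where
    maximal-first : MaximalFirst (reverse Ls)
    maximal-first = AllPairs-reverse⁺ (AllPairs-lookup⁺ Ls (λ k l k<l l<k → <-asym k<l (ordered l k l<k)))

    map-reverse : map proj₁ (reverse Ls) ≡ reverse (map proj₁ Ls)
    map-reverse = reverse-map proj₁ Ls

    unique′ : AllPairs _≢_ (map proj₁ (reverse Ls))
    unique′ = subst (AllPairs _≢_) (sym map-reverse) (AllPairs-reverse⁺ (AllPairs.map ≢-sym unique))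

    O⊆Boxes : ∀ x → x ∈O O → Boxes (reverse Ls) x
    O⊆Boxes x p = subst (x ∈_) (sym map-reverse) (reverse⁺ (complete x p))

    down : DownClosed (Boxes (reverse Ls))
    down x y y∈Q x∈ y≤x = O⊆Boxes y (O-down x y y∈Q (Boxes⊆O {reverse Ls} x∈) y≤x)

    tracks : Tracks id (Boxes (reverse Ls))
    tracks = Tracks-resp {id} {_∈O O} O⊆Boxes (λ x → Boxes⊆O {reverse Ls}) tracks-initial

  BadBox⇔Forbidden : BadBox O D ⇔ Forbidden j
  BadBox⇔Forbidden = mk⇔ to from
    where
    to : BadBox O D → Forbidden j
    to (r , c , p , zero-at , (suc r″ , p′ , s≤s r≤r″ , plus-below) , (c′ , p″ , c′<c , plus-left)) =
      r″ , c , proj₁ (proj₂ (O⊆Q _ p′)) , proj₂ (proj₂ (proj₂ (O⊆Q _ p))) ,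
      (r , c′ , proj₁ (O⊆Q _ p) , r≤r″ , proj₁ (proj₂ (proj₂ (O⊆Q _ p″))) , c′<c ,
       trans (D⁺≡D p) zero-at , trans (D⁺≡D p″) plus-left) ,
      trans (D⁺≡D p′) plus-below
    from : Forbidden j → BadBox O D
    from (r″ , c , r″<j , c≤a , (r , c′ , 1≤r , r≤r″ , 1≤c′ , c′<c , zero-at , plus-left) , plus-below) =
      r , c , p , trans (sym (D⁺≡D p)) zero-at ,
      (suc r″ , p′ , s≤s r≤r″ , trans (sym (D⁺≡D p′)) plus-below) ,
      (c′ , p″ , c′<c , trans (sym (D⁺≡D p″)) plus-left)
      where
      p : (r , c) ∈O O
      p = orPlus-zer⇒T (O (r , c)) (D (r , c)) zero-at
      q : InQ n j (suc r″ , c)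
      q = z<s , r″<j , ≤-trans 1≤c′ (<⇒≤ c′<c) , c≤a
      p′ : (suc r″ , c) ∈O O
      p′ = O-down _ _ q p (≤Q-upward q 1≤r (m≤n⇒m≤1+n r≤r″))
      q′ : InQ n j (r , c′)
      q′ = 1≤r , proj₁ (proj₂ (O⊆Q _ p)) , 1≤c′ , ≤-trans (<⇒≤ c′<c) c≤a
      p″ : (r , c′) ∈O O
      p″ = O-down _ _ q′ p (≤Q-rightward q′ c≤a (<⇒≤ c′<c))

mainTheorem1 : (n j : ℕ) → 1 ≤ j → j ≤ n ∸ 1 →
    (O : Shape) → IsOrderIdeal n j O →
    (D : Diagram O) →
    (L : List (ElemO O)) → IsLinExt n j O L →
    (IsΓ n O D L ⇔ (¬ BadBox O D))
mainTheorem1 n j _ j≤n-1 O OI D L linExt = begin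
  IsΓ n O D L     ≈⟨ IsΓ⇔AllGood L linExt ⟩
  AllGood j       ≈⟨ AllGood⇔¬Forbidden j ⟩
  (¬ Forbidden j) ≈⟨ ¬-cong-⇔ BadBox⇔Forbidden ⟨
  (¬ BadBox O D)  ∎
  where
  open Simulation n j (≤-trans j≤n-1 (m∸n≤m n 1)) O D OI
  open ⇔-Reasoning
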